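{- Let $\mathcal{L}$ be a finite congruence-uniform lattice. Then $\Psi(\hat{1})=\mathcal{J}(\mathcal{L})$ if and only if $\mu_{\mathcal{L}}(\hat{0},\hat{1})\neq 0$.
   Context: For a finite lattice $\mathcal{L}=(L,\leq)$, $\mathcal{J}(\mathcal{L})$ denotes the set of join-irreducible elements; each $j\in\mathcal{J}(\mathcal{L})$ has a unique lower cover $j_*$. For a cover relation $u\lessdot v$, $\mathrm{cg}(u,v)$ is the finest lattice congruence in which $u,v$ are equivalent, and $\mathrm{cg}(j)=\mathrm{cg}(j_*,j)$; the join-irreducible elements of the congruence lattice are exactly the $\mathrm{cg}(j)$. A finite lattice is congruence-uniform if $j\mapsto\mathrm{cg}(j)$ is a bijection from $\mathcal{J}(\mathcal{L})$ onto the join-irreducible congruences, for both $\mathcal{L}$ and its dual. For a cover $u\lessdot v$, $j_{\mathrm{cg}(u,v)}$ denotes the unique $j\in\mathcal{J}(\mathcal{L})$ with $\mathrm{cg}(j)=\mathrm{cg}(u,v)$. The nucleus of $x$ is $x_\downarrow=\bigwedge\{y\mid y\lessdot x\}$; the core label set is $\Psi(x)=\{j_{\mathrm{cg}(u,v)}\mid x_\downarrow\le u\lessdot v\le x\}$. $\mu_{\mathcal{L}}$ is the Möbius function: $\mu(x,x)=1$, $\mu(x,y)=-\sum_{x\le z<y}\mu(x,z)$ for $x<y$, $0$ otherwise. -}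

module Defs where

open import Level using (0ℓ) renaming (suc to lsuc)
open import Data.Nat using (ℕ; zero; suc)
open import Data.Fin using (Fin)
open import Data.Fin.Properties using (all?; _≟_)
open import Data.List using (List; foldr; filter)
open import Data.List using (allFin)
open import Data.Integer using (ℤ; -_) renaming (_+_ to _+ℤ_; 0ℤ to 0ℤ; 1ℤ to 1ℤ)
open import Data.Product using (_×_; _,_; ∃; ∃-syntax)
open import Data.Sum using (_⊎_)
open import Function using (flip; _⇔_)
open import Relation.Nullary using (¬_; Dec; yes; no; ¬?)
open import Relation.Nullary.Decidable using (_×-dec_; _→-dec_)
open import Relation.Binary using (Rel; Decidable; Maximum; Minimum)
open import Relation.Binary.PropositionalEquality using (_≡_; _≢_)
open import Relation.Binary.Lattice using (IsLattice; Lattice)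
open import Algebra.Core using (Op₂)
import Relation.Binary.Lattice.Properties.Lattice as LatticeProps

-- The carrier is Fin n (any finite set up to
-- relabelling), equality is propositional equality, the order is
-- decidable.  ⊤ and ⊥ are the top 1̂ and bottom 0̂ (which exist in
-- every finite nonempty lattice).

record FiniteLattice : Set₁ where
  infix  4 _≤_
  infixr 6 _∨_
  infixr 7 _∧_
  field
    n         : ℕ
    _≤_       : Rel (Fin n) 0ℓ
    _≤?_      : Decidable _≤_
    _∨_       : Op₂ (Fin n)
    _∧_       : Op₂ (Fin n)
    isLattice : IsLattice _≡_ _≤_ _∨_ _∧_
    ⊤         : Fin n
    ⊥         : Fin n
    ⊤-max     : Maximum _≤_ ⊤
    ⊥-min     : Minimum _≤_ ⊥

  lattice : Lattice 0ℓ 0ℓ 0ℓ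
  lattice = record { isLattice = isLattice }

dual : FiniteLattice → FiniteLattice
dual L = record
  { n         = n
  ; _≤_       = flip _≤_
  ; _≤?_      = flip _≤?_
  ; _∨_       = _∧_
  ; _∧_       = _∨_
  ; isLattice = LatticeProps.∧-∨-isLattice lattice
  ; ⊤         = ⊥
  ; ⊥         = ⊤
  ; ⊤-max     = ⊥-min
  ; ⊥-min     = ⊤-max
  }
  where open FiniteLattice L

module _ (L : FiniteLattice) where
  open FiniteLattice L

  _<_ : Rel (Fin n) 0ℓ
  x < y = x ≤ y × x ≢ y

  _<?_ : Decidable _<_
  x <? y = (x ≤? y) ×-dec ¬? (x ≟ y)

  _⋖_ : Rel (Fin n) 0ℓ
  u ⋖ v = u < v × (∀ w → u < w → ¬ (w < v))

  _⋖?_ : Decidable _⋖_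
  u ⋖? v = (u <? v) ×-dec all? (λ w → (u <? w) →-dec ¬? (w <? v))

  IsJoinIrreducible : Fin n → Set
  IsJoinIrreducible j = j ≢ ⊥ × (∀ x y → x ∨ y ≡ j → x ≡ j ⊎ y ≡ j)

  record Congruence : Set₁ where
    field
      rel   : Rel (Fin n) 0ℓ
      refl  : ∀ x → rel x x
      sym   : ∀ {x y} → rel x y → rel y x
      trans : ∀ {x y z} → rel x y → rel y z → rel x z
      ∨-compat : ∀ {x y z w} → rel x y → rel z w → rel (x ∨ z) (y ∨ w)
      ∧-compat : ∀ {x y z w} → rel x y → rel z w → rel (x ∧ z) (y ∧ w)

  open Congruence public

  _⊆ᶜ_ : Congruence → Congruence → Set
  θ ⊆ᶜ ψ = ∀ x y → rel θ x y → rel ψ x y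

  _≐ᶜ_ : Congruence → Congruence → Set
  θ ≐ᶜ ψ = θ ⊆ᶜ ψ × ψ ⊆ᶜ θ

  IsJoinᶜ : Congruence → Congruence → Congruence → Set₁
  IsJoinᶜ ψ₁ ψ₂ θ = ψ₁ ⊆ᶜ θ × ψ₂ ⊆ᶜ θ
                   × (∀ χ → ψ₁ ⊆ᶜ χ → ψ₂ ⊆ᶜ χ → θ ⊆ᶜ χ)

  IsBottomᶜ : Congruence → Set
  IsBottomᶜ θ = ∀ x y → rel θ x y → x ≡ y

  IsJoinIrreducibleᶜ : Congruence → Set₁
  IsJoinIrreducibleᶜ θ =
    ¬ IsBottomᶜ θ
    × (∀ ψ₁ ψ₂ → IsJoinᶜ ψ₁ ψ₂ θ → θ ≐ᶜ ψ₁ ⊎ θ ≐ᶜ ψ₂)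

  IsCg : Congruence → Fin n → Fin n → Set₁
  IsCg θ u v = rel θ u v × (∀ ψ → rel ψ u v → θ ⊆ᶜ ψ)

  -- cg(u , v) = cg(u' , v'), unfolded: a congruence identifies u,v iff
  -- it identifies u',v'  (cg(u,v) ⊆ θ ⇔ θ u v)
  SameCg : Fin n → Fin n → Fin n → Fin n → Set₁
  SameCg u v u' v' = ∀ θ → (rel θ u v → rel θ u' v') × (rel θ u' v' → rel θ u v)

  -- Join-congruence-uniformity of L:  j ↦ cg(j) = cg(j_* , j) is a
  -- bijection from J(L) onto the join-irreducible congruences.
  -- (j_* is the unique lower cover of j.)

  JoinCgBijective : Set₁
  JoinCgBijective =
    (∀ j j* θ → IsJoinIrreducible j → j* ⋖ j → IsCg θ j* j
              → IsJoinIrreducibleᶜ θ)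
    × (∀ j j* k k* → IsJoinIrreducible j → IsJoinIrreducible k
              → j* ⋖ j → k* ⋖ k → SameCg j* j k* k → j ≡ k)
    × (∀ θ → IsJoinIrreducibleᶜ θ
              → ∃[ j ] ∃[ j* ] (IsJoinIrreducible j × j* ⋖ j × IsCg θ j* j))

  nucleus : Fin n → Fin n
  nucleus x = foldr _∧_ ⊤ (filter (λ y → y ⋖? x) (allFin n))

  -- core label set:  j ∈ Ψ(x)  iff  j = j_{cg(u,v)} for some cover
  -- x↓ ≤ u ⋖ v ≤ x, i.e. j ∈ J(L) and cg(j_* , j) = cg(u , v).
  _∈Ψ_ : Fin n → Fin n → Set₁
  j ∈Ψ x = IsJoinIrreducible j
           × ∃[ u ] ∃[ v ] ∃[ j* ]
               (nucleus x ≤ u × u ⋖ v × v ≤ x × j* ⋖ j × SameCg u v j* j)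

  -- The recursion is run
  -- with fuel; fuel n suffices since every chain x = z₀ < … < z_m = y
  -- has m < n (so μ below is the genuine Möbius function).
  μ-fuel : ℕ → Fin n → Fin n → ℤ
  μ-fuel zero    x y = 0ℤ
  μ-fuel (suc k) x y with x ≟ y | x ≤? y
  ... | yes _ | _     = 1ℤ
  ... | no _  | no _  = 0ℤ
  ... | no _  | yes _ =
    - foldr (λ z acc → μ-fuel k x z +ℤ acc) 0ℤ
            (filter (λ z → (x ≤? z) ×-dec (z <? y)) (allFin n))

  μ : Fin n → Fin n → ℤ
  μ = μ-fuel n

IsCongruenceUniform : FiniteLattice → Set₁
IsCongruenceUniform L = JoinCgBijective L × JoinCgBijective (dual L)

module Submission where

-- Only injectivity of j ↦ cg(j) on J(L) is used. It gives every cover u ⋖ v a unique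
-- join-irreducible label j with cg(j) = cg(u, v), found as a minimal element of {t ≤ v | t ≰ u};
-- since labels of u ⋖ v below y and below z coincide, L is join-semidistributive.
-- By Rota's crosscut theorem for the coatoms, μ(0̂, 1̂) is the sum of (-1)^|S| over the sets S
-- of coatoms with ⋀S = 0̂. If the nucleus 1̂↓ = ⋀(coatoms) is not 0̂ the sum is empty. If it is
-- 0̂, join-semidistributivity gives c ∨ ⋀S = 1̂ for every coatom c ∉ S, so only the set of all
-- coatoms contributes and μ(0̂, 1̂) = ±1. Finally Ψ(1̂) = J(L) exactly when 1̂↓ = 0̂: each j is
-- the label of its own cover j_* ⋖ j, which lies above 0̂, whereas an atom below 1̂↓ ≠ 0̂ is
-- join-irreducible but labels no cover above 1̂↓.

open import Level using (Level; 0ℓ)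
open import Data.Bool using (if_then_else_)
open import Data.Nat as ℕ using (ℕ; zero; suc)
import Data.Nat.Properties as ℕ
open import Data.Integer using (ℤ; 0ℤ; 1ℤ; -1ℤ; _+_; _*_; -_; _^_)
import Data.Integer.Properties as ℤ
open import Data.Fin using (Fin; zero; suc)
open import Data.Fin.Properties using (all?; any?; _≟_)
open import Data.Fin.Induction using (spo-wellFounded)
open import Data.Fin.Subset using (Subset; inside; outside; _∈_; _∉_; _⊆_; ∣_∣; Lift)
open import Data.Fin.Subset.Properties
  using (Lift?; _∈?_; p⊂q⇒∣p∣<∣q∣; ∣⊤∣≡n; ∈⊤; ⊆-antisym)
open import Data.Vec using ([]; _∷_; here; there)
open import Data.Vec.Properties using (∷-injectiveʳ)
open import Data.List using ([]; _∷_; foldr; filter; tabulate; allFin)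
open import Data.List.Membership.Propositional using () renaming (_∈_ to _∈ₗ_)
open import Data.List.Membership.Propositional.Properties using (∈-allFin)
open import Data.List.Relation.Unary.Any using (here; there)
open import Data.Product using (_×_; _,_; proj₁; proj₂; ∃-syntax)
open import Data.Sum using (_⊎_; inj₁; inj₂)
open import Algebra.Properties.Semiring.Sum ℤ.+-*-semiring
  using (sum-syntax; sum-cong-≗; sum-replicate-zero; ∑-distrib-+; *-distribˡ-sum)
open import Function using (id; _∘_; flip; _⇔_; mk⇔; Equivalence)
open import Induction.WellFounded using (WellFounded; Acc; acc)
open import Relation.Nullary using (Dec; yes; no; does; ¬_; contradiction)
open import Relation.Nullary.Decidable using (_×-dec_; _⊎-dec_; ¬?; decidable-stable)
open import Relation.Unary using (Pred; Decidable)
open import Relation.Binary using (Rel) renaming (Decidable to Decidable₂)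
open import Relation.Binary.Lattice using (IsLattice; Lattice)
import Relation.Binary.Construct.Flip.EqAndOrd as Flip
open import Relation.Binary.PropositionalEquality
  using (_≡_; _≢_; refl; sym; trans; cong; cong₂; subst; subst₂; module ≡-Reasoning)

open import Defs using (FiniteLattice; rel; ∨-compat; ∧-compat)
import Defs

private
  variable
    ℓ p : Level
    A B : Set ℓ
    m : ℕ

𝟙 : Dec A → ℤ
𝟙 a? = if does a? then 1ℤ else 0ℤ

𝟙-yes : (a? : Dec A) → A → 𝟙 a? ≡ 1ℤ
𝟙-yes (yes _) _ = refl
𝟙-yes (no ¬a) a = contradiction a ¬a

𝟙-no : (a? : Dec A) → ¬ A → 𝟙 a? ≡ 0ℤ
𝟙-no (yes a) ¬a = contradiction a ¬a
𝟙-no (no _) _ = refl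

𝟙-cong : A ⇔ B → (a? : Dec A) (b? : Dec B) → 𝟙 a? ≡ 𝟙 b?
𝟙-cong A⇔B a? (yes b) = 𝟙-yes a? (Equivalence.from A⇔B b)
𝟙-cong A⇔B a? (no ¬b) = 𝟙-no a? (¬b ∘ Equivalence.to A⇔B)

𝟙-× : (a? : Dec A) (b? : Dec B) → 𝟙 (a? ×-dec b?) ≡ 𝟙 a? * 𝟙 b?
𝟙-× (yes _) (yes _) = refl
𝟙-× (yes _) (no _)  = refl
𝟙-× (no _)  _       = refl

𝟙-⊎ : ¬ (A × B) → (a? : Dec A) (b? : Dec B) → 𝟙 (a? ⊎-dec b?) ≡ 𝟙 a? + 𝟙 b?
𝟙-⊎ A∩B=∅ (yes a) (yes b) = contradiction (a , b) A∩B=∅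
𝟙-⊎ _     (yes _) (no _)  = refl
𝟙-⊎ _     (no _)  (yes _) = refl
𝟙-⊎ _     (no _)  (no _)  = refl

𝟙-*-cong : ∀ {x y} (a? : Dec A) → (A → x ≡ y) → 𝟙 a? * x ≡ 𝟙 a? * y
𝟙-*-cong (yes a) x≡y = cong (1ℤ *_) (x≡y a)
𝟙-*-cong (no _)  _   = refl

𝟙-*-zero : ∀ {x} (a? : Dec A) → ¬ A → 𝟙 a? * x ≡ 0ℤ
𝟙-*-zero (yes a) ¬a = contradiction a ¬a
𝟙-*-zero (no _)  _  = refl

∑-zero : ∀ {n} {f : Fin n → ℤ} → (∀ i → f i ≡ 0ℤ) → ∑[ i < n ] f i ≡ 0ℤ
∑-zero {n} f≗0 = trans (sum-cong-≗ f≗0) (sum-replicate-zero n)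

∑-δ : ∀ {n} (a : Fin n) (f : Fin n → ℤ) → ∑[ i < n ] (𝟙 (i ≟ a) * f i) ≡ f a
∑-δ zero    f = trans (cong (1ℤ * f zero +_) (∑-zero {f = λ i → 0ℤ * f (suc i)} λ _ → refl))
                      (trans (ℤ.+-identityʳ (1ℤ * f zero)) (ℤ.*-identityˡ (f zero)))
∑-δ (suc a) f = trans (ℤ.+-identityˡ _) (∑-δ a (f ∘ suc))

foldr-filter-∑ : {P : Pred A p} (P? : Decidable P) (g : A → ℤ) (f : Fin m → A) →
                 foldr (λ z acc → g z + acc) 0ℤ (filter P? (tabulate f))
                   ≡ ∑[ i < m ] (𝟙 (P? (f i)) * g (f i))
foldr-filter-∑ {m = zero}  P? g f = refl
foldr-filter-∑ {m = suc m} P? g f with P? (f zero)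
... | yes _ = cong₂ _+_ (sym (ℤ.*-identityˡ (g (f zero)))) (foldr-filter-∑ P? g (f ∘ suc))
... | no _  = trans (foldr-filter-∑ P? g (f ∘ suc)) (sym (ℤ.+-identityˡ _))

∑ˢ : (Subset m → ℤ) → ℤ
∑ˢ {zero}  F = F []
∑ˢ {suc m} F = ∑ˢ (F ∘ (outside ∷_)) + ∑ˢ (F ∘ (inside ∷_))

∑ˢ-cong : {F G : Subset m → ℤ} → (∀ S → F S ≡ G S) → ∑ˢ F ≡ ∑ˢ G
∑ˢ-cong {zero}  F≗G = F≗G []
∑ˢ-cong {suc m} F≗G = cong₂ _+_ (∑ˢ-cong (F≗G ∘ (outside ∷_))) (∑ˢ-cong (F≗G ∘ (inside ∷_)))

∑ˢ-zero : {F : Subset m → ℤ} → (∀ S → F S ≡ 0ℤ) → ∑ˢ F ≡ 0ℤ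
∑ˢ-zero {zero}  F≗0 = F≗0 []
∑ˢ-zero {suc m} F≗0 = cong₂ _+_ (∑ˢ-zero (F≗0 ∘ (outside ∷_))) (∑ˢ-zero (F≗0 ∘ (inside ∷_)))

*-distribˡ-∑ˢ : ∀ x (F : Subset m → ℤ) → x * ∑ˢ F ≡ ∑ˢ (λ S → x * F S)
*-distribˡ-∑ˢ {zero}  x F = refl
*-distribˡ-∑ˢ {suc m} x F = trans (ℤ.*-distribˡ-+ x _ _)
  (cong₂ _+_ (*-distribˡ-∑ˢ x (F ∘ (outside ∷_))) (*-distribˡ-∑ˢ x (F ∘ (inside ∷_))))

∑-∑ˢ-comm : ∀ {n} (F : Fin n → Subset m → ℤ) →
            ∑[ i < n ] ∑ˢ (F i) ≡ ∑ˢ (λ S → ∑[ i < n ] F i S)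
∑-∑ˢ-comm {zero}      F = refl
∑-∑ˢ-comm {suc m} {n} F = begin
  ∑[ i < n ] (∑ˢ (λ S → F i (outside ∷ S)) + ∑ˢ (λ S → F i (inside ∷ S)))
    ≡⟨ ∑-distrib-+ (λ i → ∑ˢ (F i ∘ (outside ∷_))) (λ i → ∑ˢ (F i ∘ (inside ∷_))) ⟩
  ∑[ i < n ] ∑ˢ (λ S → F i (outside ∷ S)) + ∑[ i < n ] ∑ˢ (λ S → F i (inside ∷ S))
    ≡⟨ cong₂ _+_ (∑-∑ˢ-comm (λ i → F i ∘ (outside ∷_)))
                 (∑-∑ˢ-comm (λ i → F i ∘ (inside ∷_))) ⟩
  ∑ˢ (λ S → ∑[ i < n ] F i (outside ∷ S)) + ∑ˢ (λ S → ∑[ i < n ] F i (inside ∷ S)) ∎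
  where open ≡-Reasoning

∑ˢ-single : (F : Subset m → ℤ) (S₀ : Subset m) →
            (∀ S → S ≢ S₀ → F S ≡ 0ℤ) → ∑ˢ F ≡ F S₀
∑ˢ-single F []            _   = refl
∑ˢ-single F (outside ∷ S₀) F≗0 = trans
  (cong₂ _+_ (∑ˢ-single (F ∘ (outside ∷_)) S₀ λ S S≢S₀ → F≗0 _ (S≢S₀ ∘ ∷-injectiveʳ))
             (∑ˢ-zero λ S → F≗0 (inside ∷ S) λ ()))
  (ℤ.+-identityʳ _)
∑ˢ-single F (inside ∷ S₀)  F≗0 = trans
  (cong₂ _+_ (∑ˢ-zero λ S → F≗0 (outside ∷ S) λ ())
             (∑ˢ-single (F ∘ (inside ∷_)) S₀ λ S S≢S₀ → F≗0 _ (S≢S₀ ∘ ∷-injectiveʳ)))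
  (ℤ.+-identityˡ _)

module _ {P : Pred (Fin (suc m)) p} {S : Subset m} where

  Lift-outside∷ : Lift P (outside ∷ S) ⇔ Lift (P ∘ suc) S
  Lift-outside∷ = mk⇔ (λ P[S] {x} x∈S → P[S] (there x∈S)) from
    where
    from : Lift (P ∘ suc) S → Lift P (outside ∷ S)
    from P[S] (there x∈S) = P[S] x∈S

  Lift-inside∷ : P zero → Lift P (inside ∷ S) ⇔ Lift (P ∘ suc) S
  Lift-inside∷ P0 = mk⇔ (λ P[S] {x} x∈S → P[S] (there x∈S)) from
    where
    from : Lift (P ∘ suc) S → Lift P (inside ∷ S)
    from _    here          = P0
    from P[S] (there x∈S) = P[S] x∈S

∑ˢ-alternating : {P : Pred (Fin m) p} (P? : Decidable P) →
                 ∑ˢ (λ S → -1ℤ ^ ∣ S ∣ * 𝟙 (Lift? P? S)) ≡ 𝟙 (all? (¬? ∘ P?))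
∑ˢ-alternating {zero} P? =
  trans (cong (1ℤ *_) (𝟙-yes (Lift? P? []) λ ())) (sym (𝟙-yes (all? (¬? ∘ P?)) λ ()))
∑ˢ-alternating {suc m} {P = P} P? = by-head (P? zero)
  where
  open ≡-Reasoning
  tail-term : Subset m → ℤ
  tail-term S = -1ℤ ^ ∣ S ∣ * 𝟙 (Lift? (P? ∘ suc) S)
  outside-part : ∑ˢ (λ S → -1ℤ ^ ∣ S ∣ * 𝟙 (Lift? P? (outside ∷ S))) ≡ ∑ˢ tail-term
  outside-part = ∑ˢ-cong λ S →
    cong (-1ℤ ^ ∣ S ∣ *_) (𝟙-cong Lift-outside∷ (Lift? P? (outside ∷ S)) (Lift? (P? ∘ suc) S))
  by-head : Dec (P zero) → ∑ˢ (λ S → -1ℤ ^ ∣ S ∣ * 𝟙 (Lift? P? S)) ≡ 𝟙 (all? (¬? ∘ P?))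
  by-head (no ¬P0) = begin
    ∑ˢ (λ S → -1ℤ ^ ∣ S ∣ * 𝟙 (Lift? P? (outside ∷ S)))
      + ∑ˢ (λ S → -1ℤ ^ suc ∣ S ∣ * 𝟙 (Lift? P? (inside ∷ S)))
      ≡⟨ cong₂ _+_ outside-part (∑ˢ-zero λ S → 𝟙-zero S) ⟩
    ∑ˢ tail-term + 0ℤ
      ≡⟨ trans (ℤ.+-identityʳ _) (∑ˢ-alternating (P? ∘ suc)) ⟩
    𝟙 (all? (¬? ∘ P? ∘ suc))
      ≡⟨ 𝟙-cong (mk⇔ (λ ¬P[suc] → λ { zero → ¬P0 ; (suc i) → ¬P[suc] i }) (_∘ suc))
                (all? (¬? ∘ P? ∘ suc)) (all? (¬? ∘ P?)) ⟩
    𝟙 (all? (¬? ∘ P?)) ∎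
    where
    𝟙-zero : ∀ S → -1ℤ ^ suc ∣ S ∣ * 𝟙 (Lift? P? (inside ∷ S)) ≡ 0ℤ
    𝟙-zero S = trans (cong (-1ℤ ^ suc ∣ S ∣ *_) (𝟙-no (Lift? P? (inside ∷ S)) λ P[S] → ¬P0 (P[S] here)))
                     (ℤ.*-zeroʳ (-1ℤ ^ suc ∣ S ∣))
  by-head (yes P0) = begin
    ∑ˢ (λ S → -1ℤ ^ ∣ S ∣ * 𝟙 (Lift? P? (outside ∷ S)))
      + ∑ˢ (λ S → -1ℤ * -1ℤ ^ ∣ S ∣ * 𝟙 (Lift? P? (inside ∷ S)))
      ≡⟨ cong₂ _+_ outside-part (∑ˢ-cong negated-tail) ⟩
    ∑ˢ tail-term + ∑ˢ (λ S → -1ℤ * tail-term S)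
      ≡⟨ cong (∑ˢ tail-term +_) (trans (sym (*-distribˡ-∑ˢ -1ℤ tail-term)) (ℤ.-1*i≡-i (∑ˢ tail-term))) ⟩
    ∑ˢ tail-term + - ∑ˢ tail-term
      ≡⟨ ℤ.+-inverseʳ (∑ˢ tail-term) ⟩
    0ℤ
      ≡⟨ sym (𝟙-no (all? (¬? ∘ P?)) (λ ¬P → ¬P zero P0)) ⟩
    𝟙 (all? (¬? ∘ P?)) ∎
    where
    negated-tail : ∀ S → -1ℤ * -1ℤ ^ ∣ S ∣ * 𝟙 (Lift? P? (inside ∷ S)) ≡ -1ℤ * tail-term S
    negated-tail S = trans (ℤ.*-assoc -1ℤ (-1ℤ ^ ∣ S ∣) _) (cong (λ t → -1ℤ * (-1ℤ ^ ∣ S ∣ * t))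
      (𝟙-cong (Lift-inside∷ P0) (Lift? P? (inside ∷ S)) (Lift? (P? ∘ suc) S)))

⟦_⟧ : {P : Pred (Fin m) p} → Decidable P → Subset m
⟦_⟧ {zero}  P? = []
⟦_⟧ {suc m} P? = does (P? zero) ∷ ⟦ P? ∘ suc ⟧

∈⟦⟧ : {P : Pred (Fin m) p} (P? : Decidable P) {x : Fin m} → x ∈ ⟦ P? ⟧ ⇔ P x
∈⟦⟧ {suc m} {P = P} P? {x} = mk⇔ (to (P? zero) x) (from (P? zero) x)
  where
  to : (P0? : Dec (P zero)) → ∀ x → x ∈ does P0? ∷ ⟦ P? ∘ suc ⟧ → P x
  to (yes P0) zero    here        = P0
  to _        (suc x) (there x∈S) = Equivalence.to (∈⟦⟧ (P? ∘ suc)) x∈S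
  from : (P0? : Dec (P zero)) → ∀ x → P x → x ∈ does P0? ∷ ⟦ P? ∘ suc ⟧
  from (yes _)  zero    _  = here
  from (no ¬P0) zero    P0 = contradiction P0 ¬P0
  from _        (suc x) Px = there (Equivalence.from (∈⟦⟧ (P? ∘ suc)) Px)

module _ {n r} {_⊏_ : Rel (Fin n) r} (⊏-wellFounded : WellFounded _⊏_) (_⊏?_ : Decidable₂ _⊏_) where

  ∃-minimal : {P : Pred (Fin n) p} → Decidable P → ∀ {x} → P x →
              ∃[ y ] P y × (∀ {t} → P t → ¬ t ⊏ y)
  ∃-minimal {P = P} P? {x} Px = descend (⊏-wellFounded x) Px
    where
    descend : ∀ {x} → Acc _⊏_ x → P x → ∃[ y ] P y × (∀ {t} → P t → ¬ t ⊏ y)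
    descend {x} (acc below) Px with any? (λ t → P? t ×-dec t ⊏? x)
    ... | yes (t , Pt , t⊏x) = descend (below t⊏x) Pt
    ... | no  ∄t            = x , Px , λ Pt t⊏x → ∄t (_ , Pt , t⊏x)

module Properties (L : FiniteLattice) where

  open FiniteLattice L
  open Equivalence using (to; from)
  open IsLattice isLattice
    using (x≤x∨y; y≤x∨y; ∨-least; x∧y≤x; x∧y≤y; ∧-greatest)
    renaming (refl to ≤-refl; trans to ≤-trans; antisym to ≤-antisym; reflexive to ≤-reflexive)
  open import Relation.Binary.Properties.Poset (Lattice.poset lattice)
    using (<-irrefl; <-trans; <⇒≱; <-isStrictPartialOrder)
  open import Relation.Binary.Lattice.Properties.JoinSemilattice (Lattice.joinSemilattice lattice)
    using (∨-comm; x≤y⇒x∨y≈y)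
  open import Relation.Binary.Lattice.Properties.MeetSemilattice (Lattice.meetSemilattice lattice)
    using (y≤x⇒x∧y≈y)

  _<_ : Rel (Fin n) 0ℓ
  _<_ = Defs._<_ L

  _<?_ : Decidable₂ _<_
  _<?_ = Defs._<?_ L

  _⋖_ : Rel (Fin n) 0ℓ
  _⋖_ = Defs._⋖_ L

  _⋖?_ : Decidable₂ _⋖_
  _⋖?_ = Defs._⋖?_ L

  IsJoinIrreducible : Pred (Fin n) 0ℓ
  IsJoinIrreducible = Defs.IsJoinIrreducible L

  SameCg : Fin n → Fin n → Fin n → Fin n → Set₁
  SameCg = Defs.SameCg L

  nucleus : Fin n → Fin n
  nucleus = Defs.nucleus L

  _∈Ψ_ : Fin n → Fin n → Set₁
  _∈Ψ_ = Defs._∈Ψ_ L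

  μ-fuel : ℕ → Fin n → Fin n → ℤ
  μ-fuel = Defs.μ-fuel L

  μ : Fin n → Fin n → ℤ
  μ = Defs.μ L

  private
    variable
      a c d i j k t u v w x y z : Fin n
      P : Pred (Fin n) p

  <-wellFounded : WellFounded _<_
  <-wellFounded = spo-wellFounded <-isStrictPartialOrder

  >-wellFounded : WellFounded (flip _<_)
  >-wellFounded = spo-wellFounded (Flip.isStrictPartialOrder <-isStrictPartialOrder)

  ∃-maximal : Decidable P → P x → ∃[ y ] P y × (∀ {t} → P t → ¬ y < t)
  ∃-maximal P? = ∃-minimal >-wellFounded (flip _<?_) P?

  ⋖-between : ∀ {u v t} → u ⋖ v → u < t → t ≤ v → t ≡ v
  ⋖-between {v = v} {t} (_ , nothing-between) u<t t≤v with t ≟ v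
  ... | yes t≡v = t≡v
  ... | no  t≢v = contradiction (t≤v , t≢v) (nothing-between t u<t)

  ∃-⋖-below : ∀ {x y} → x < y → ∃[ u ] x ≤ u × u ⋖ y
  ∃-⋖-below {x} {y} x<y with ∃-maximal (λ t → (x ≤? t) ×-dec (t <? y)) (≤-refl , x<y)
  ... | u , (x≤u , u<y) , u-max = u , x≤u , u<y , λ w u<w w<y → u-max (≤-trans x≤u (proj₁ u<w) , w<y) u<w

  ∃-⋖-above : ∀ {x y} → x < y → ∃[ a ] x ⋖ a × a ≤ y
  ∃-⋖-above {x} {y} x<y with ∃-minimal <-wellFounded _<?_ (λ t → (x <? t) ×-dec (t ≤? y)) (x<y , ≤-refl)
  ... | a , (x<a , a≤y) , a-min = a , (x<a , λ w x<w w<a → a-min (x<w , ≤-trans (proj₁ w<a) a≤y) w<a) , a≤y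

  ≢⊥⇒⊥< : x ≢ ⊥ → ⊥ < x
  ≢⊥⇒⊥< x≢⊥ = ⊥-min _ , x≢⊥ ∘ sym

  joinIrreducible-if-below≤ : ¬ k ≤ u → (∀ {t} → t < k → t ≤ u) → IsJoinIrreducible k
  joinIrreducible-if-below≤ {k} {u} k≰u below-k⇒≤u = k≢⊥ , irreducible
    where
    k≢⊥ : k ≢ ⊥
    k≢⊥ refl = k≰u (⊥-min u)
    irreducible : ∀ x y → x ∨ y ≡ k → x ≡ k ⊎ y ≡ k
    irreducible x y x∨y≡k with x ≟ k | y ≟ k
    ... | yes x≡k | _       = inj₁ x≡k
    ... | no  _   | yes y≡k = inj₂ y≡k
    ... | no  x≢k | no  y≢k = contradiction (≤-trans (≤-reflexive (sym x∨y≡k)) (∨-least x≤u y≤u)) k≰u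
      where
      x≤u = below-k⇒≤u (≤-trans (x≤x∨y x y) (≤-reflexive x∨y≡k) , x≢k)
      y≤u = below-k⇒≤u (≤-trans (y≤x∨y x y) (≤-reflexive x∨y≡k) , y≢k)

  atom⇒joinIrreducible : ⊥ ⋖ a → IsJoinIrreducible a
  atom⇒joinIrreducible {a} ⊥⋖a = joinIrreducible-if-below≤ (<⇒≱ (proj₁ ⊥⋖a)) below-a⇒≤⊥
    where
    below-a⇒≤⊥ : t < a → t ≤ ⊥
    below-a⇒≤⊥ {t} t<a with t ≟ ⊥
    ... | yes t≡⊥ = ≤-reflexive t≡⊥
    ... | no  t≢⊥ = contradiction t<a (proj₂ ⊥⋖a t (≢⊥⇒⊥< t≢⊥))

  ∃-lowerCover : j ≢ ⊥ → ∃[ j* ] j* ⋖ j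
  ∃-lowerCover j≢⊥ with ∃-⋖-below (≢⊥⇒⊥< j≢⊥)
  ... | j* , _ , j*⋖j = j* , j*⋖j

  <-joinIrreducible⇒≤-lowerCover : IsJoinIrreducible j → k ⋖ j → x < j → x ≤ k
  <-joinIrreducible⇒≤-lowerCover {j} {k} {x} (_ , irreducible) k⋖j x<j with k ≟ x ∨ k
  ... | yes k≡x∨k = ≤-trans (x≤x∨y x k) (≤-reflexive (sym k≡x∨k))
  ... | no  k≢x∨k
    with irreducible x k (⋖-between k⋖j (y≤x∨y x k , k≢x∨k) (∨-least (proj₁ x<j) (proj₁ (proj₁ k⋖j))))
  ...   | inj₁ x≡j = contradiction x≡j (proj₂ x<j)
  ...   | inj₂ k≡j = contradiction k≡j (proj₂ (proj₁ k⋖j))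

  -- Defs.nucleus x unfolds to ⋀ (_⋖? x).
  ⋀ : Decidable P → Fin n
  ⋀ P? = foldr _∧_ ⊤ (filter P? (allFin n))

  ⋀-lowerBound : (P? : Decidable P) → P i → ⋀ P? ≤ i
  ⋀-lowerBound {i = i} P? Pi = go (allFin n) (∈-allFin i)
    where
    go : ∀ xs → i ∈ₗ xs → foldr _∧_ ⊤ (filter P? xs) ≤ i
    go (x ∷ xs) i∈x∷xs with P? x | i∈x∷xs
    ... | yes _  | here refl   = x∧y≤x x _
    ... | yes _  | there i∈xs  = ≤-trans (x∧y≤y x _) (go xs i∈xs)
    ... | no ¬Px | here refl   = contradiction Pi ¬Px
    ... | no _   | there i∈xs  = go xs i∈xs

  ⋀-closed : {Q : Pred (Fin n) ℓ} (P? : Decidable P) → Q ⊤ → (∀ {x y} → Q x → Q y → Q (x ∧ y)) →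
             (∀ {i} → P i → Q i) → Q (⋀ P?)
  ⋀-closed {Q = Q} P? Q⊤ Q-∧ P⇒Q = go (allFin n)
    where
    go : ∀ xs → Q (foldr _∧_ ⊤ (filter P? xs))
    go []       = Q⊤
    go (x ∷ xs) with P? x
    ... | yes Px = Q-∧ (P⇒Q Px) (go xs)
    ... | no  _  = go xs

  ⋀-greatest : (P? : Decidable P) → (∀ {i} → P i → x ≤ i) → x ≤ ⋀ P?
  ⋀-greatest {x = x} P? = ⋀-closed P? (⊤-max x) ∧-greatest

  SameCg-transpose : u ∨ k ≡ v → u ∧ k ≡ j → SameCg u v j k
  SameCg-transpose {u} {k} {v} {j} u∨k≡v u∧k≡j θ = down , up
    where
    k≤v = ≤-trans (y≤x∨y u k) (≤-reflexive u∨k≡v)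
    j≤u = ≤-trans (≤-reflexive (sym u∧k≡j)) (x∧y≤x u k)
    down : rel θ u v → rel θ j k
    down θuv = subst₂ (rel θ) u∧k≡j (y≤x⇒x∧y≈y k≤v) (∧-compat θ θuv (Defs.refl θ k))
    up : rel θ j k → rel θ u v
    up θjk =
      subst₂ (rel θ) (x≤y⇒x∨y≈y j≤u) (trans (∨-comm k u) u∨k≡v) (∨-compat θ θjk (Defs.refl θ u))

  IsCgLabel : Fin n → Fin n → Fin n → Set₁
  IsCgLabel j u v = IsJoinIrreducible j × ∃[ j* ] j* ⋖ j × SameCg u v j* j

  JoinCgInjective : Set₁
  JoinCgInjective = ∀ j j* k k* → IsJoinIrreducible j → IsJoinIrreducible k →
                    j* ⋖ j → k* ⋖ k → SameCg j* j k* k → j ≡ k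

  -- A minimal k ≤ y with k ≰ u is join-irreducible, and [k_*, k] transposes up to [u, v].
  ∃-cgLabel : u ⋖ v → y ≤ v → ¬ y ≤ u → ∃[ k ] k ≤ y × ¬ k ≤ u × IsCgLabel k u v
  ∃-cgLabel {u} {v} {y} u⋖v y≤v y≰u
    with ∃-minimal <-wellFounded _<?_ (λ t → (t ≤? y) ×-dec ¬? (t ≤? u)) (≤-refl , y≰u)
  ... | k , (k≤y , k≰u) , k-min = k , k≤y , k≰u , kJI , k* , k*⋖k , SameCg-transpose u∨k≡v u∧k≡k*
    where
    below-k⇒≤u : t < k → t ≤ u
    below-k⇒≤u {t} t<k with t ≤? u
    ... | yes t≤u = t≤u
    ... | no  t≰u = contradiction t<k (k-min (≤-trans (proj₁ t<k) k≤y , t≰u))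
    kJI = joinIrreducible-if-below≤ k≰u below-k⇒≤u
    k* = proj₁ (∃-lowerCover (proj₁ kJI))
    k*⋖k = proj₂ (∃-lowerCover (proj₁ kJI))
    u∨k≡v : u ∨ k ≡ v
    u∨k≡v = ⋖-between u⋖v
      (x≤x∨y u k , λ u≡u∨k → k≰u (≤-trans (y≤x∨y u k) (≤-reflexive (sym u≡u∨k))))
      (∨-least (proj₁ (proj₁ u⋖v)) (≤-trans k≤y y≤v))
    u∧k≡k* : u ∧ k ≡ k*
    u∧k≡k* = ≤-antisym
      (<-joinIrreducible⇒≤-lowerCover kJI k*⋖k
        (x∧y≤y u k , λ u∧k≡k → k≰u (≤-trans (≤-reflexive (sym u∧k≡k)) (x∧y≤x u k))))
      (∧-greatest (below-k⇒≤u (proj₁ k*⋖k)) (proj₁ (proj₁ k*⋖k)))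

  cgLabel-unique : JoinCgInjective → IsCgLabel j u v → IsCgLabel k u v → j ≡ k
  cgLabel-unique injective (jJI , j* , j*⋖j , uv~j) (kJI , k* , k*⋖k , uv~k) =
    injective _ j* _ k* jJI kJI j*⋖j k*⋖k λ θ →
      proj₁ (uv~k θ) ∘ proj₂ (uv~j θ) , proj₁ (uv~j θ) ∘ proj₂ (uv~k θ)

  cgLabel-≰ : JoinCgInjective → u ⋖ v → IsCgLabel j u v → ¬ j ≤ u
  cgLabel-≰ injective u⋖v j-label with ∃-cgLabel u⋖v ≤-refl (<⇒≱ (proj₁ u⋖v))
  ... | k , _ , k≰u , k-label rewrite cgLabel-unique injective j-label k-label = k≰u

  JoinSemidistributive : Set
  JoinSemidistributive = ∀ {x y z} → x ∨ y ≡ x ∨ z → x ∨ (y ∧ z) ≡ x ∨ y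

  -- y and z lie above labels of u ⋖ v, and these coincide.
  ⋖-meet-≰ : JoinCgInjective → u ⋖ v → y ≤ v → z ≤ v → ¬ y ≤ u → ¬ z ≤ u → ¬ y ∧ z ≤ u
  ⋖-meet-≰ {y = y} {z = z} injective u⋖v y≤v z≤v y≰u z≰u
    with ∃-cgLabel u⋖v y≤v y≰u | ∃-cgLabel u⋖v z≤v z≰u
  ... | k , k≤y , k≰u , k-label | l , l≤z , _ , l-label =
    λ y∧z≤u → k≰u (≤-trans (∧-greatest k≤y (≤-trans (≤-reflexive k≡l) l≤z)) y∧z≤u)
    where k≡l = cgLabel-unique injective k-label l-label

  ⋖-join-≰ : u ⋖ v → x ≤ u → x ∨ t ≡ v → ¬ t ≤ u
  ⋖-join-≰ u⋖v x≤u x∨t≡v t≤u =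
    <⇒≱ (proj₁ u⋖v) (≤-trans (≤-reflexive (sym x∨t≡v)) (∨-least x≤u t≤u))

  cgInjective⇒joinSemidistributive : JoinCgInjective → JoinSemidistributive
  cgInjective⇒joinSemidistributive injective {x} {y} {z} x∨y≡x∨z with x ∨ (y ∧ z) ≟ x ∨ y
  ... | yes equal = equal
  ... | no  p≢w with ∃-⋖-below (∨-least (x≤x∨y x y) (≤-trans (x∧y≤x y z) (y≤x∨y x y)) , p≢w)
  ...   | u , p≤u , u⋖w = contradiction (≤-trans (y≤x∨y x (y ∧ z)) p≤u)
    (⋖-meet-≰ injective u⋖w (y≤x∨y x y) (≤-trans (y≤x∨y x z) (≤-reflexive (sym x∨y≡x∨z)))
              (⋖-join-≰ u⋖w x≤u refl) (⋖-join-≰ u⋖w x≤u (sym x∨y≡x∨z)))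
    where x≤u = ≤-trans (x≤x∨y x (y ∧ z)) p≤u

  ∈Ψ⇒≰nucleus : JoinCgInjective → j ∈Ψ x → ¬ j ≤ nucleus x
  ∈Ψ⇒≰nucleus injective (jJI , u , v , j* , x↓≤u , u⋖v , _ , j*⋖j , uv~j) j≤x↓ =
    cgLabel-≰ injective u⋖v (jJI , j* , j*⋖j , uv~j) (≤-trans j≤x↓ x↓≤u)

  nucleus≡⊥⇒∈Ψ : nucleus x ≡ ⊥ → j ≤ x → IsJoinIrreducible j → j ∈Ψ x
  nucleus≡⊥⇒∈Ψ x↓≡⊥ j≤x jJI with ∃-lowerCover (proj₁ jJI)
  ... | j* , j*⋖j =
    jJI , j* , _ , j* , ≤-trans (≤-reflexive x↓≡⊥) (⊥-min j*) , j*⋖j , j≤x , j*⋖j , λ _ → id , id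

  nucleus≢⊥⇒∃joinIrreducible∉Ψ : JoinCgInjective → nucleus x ≢ ⊥ →
                                  ∃[ a ] IsJoinIrreducible a × ¬ a ∈Ψ x
  nucleus≢⊥⇒∃joinIrreducible∉Ψ injective x↓≢⊥ with ∃-⋖-above (≢⊥⇒⊥< x↓≢⊥)
  ... | a , ⊥⋖a , a≤x↓ =
    a , atom⇒joinIrreducible ⊥⋖a , λ a∈Ψx → ∈Ψ⇒≰nucleus injective a∈Ψx a≤x↓

  -- height y bounds the recursion depth of μ-fuel at y.
  height : Fin n → ℕ
  height y = ∣ ⟦ _<? y ⟧ ∣

  height-mono : z < y → height z ℕ.< height y
  height-mono {z} {y} z<y = p⊂q⇒∣p∣<∣q∣ (below-z⊆below-y , z , from (∈⟦⟧ (_<? y)) z<y , z∉below-z)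
    where
    below-z⊆below-y : ⟦ _<? z ⟧ ⊆ ⟦ _<? y ⟧
    below-z⊆below-y t∈ = from (∈⟦⟧ (_<? y)) (<-trans (to (∈⟦⟧ (_<? z)) t∈) z<y)
    z∉below-z : z ∉ ⟦ _<? z ⟧
    z∉below-z z∈ = <-irrefl refl (to (∈⟦⟧ (_<? z)) z∈)

  height<n : height y ℕ.< n
  height<n {y} = subst (height y ℕ.<_) (∣⊤∣≡n n)
    (p⊂q⇒∣p∣<∣q∣ ((λ _ → ∈⊤) , y , ∈⊤ , λ y∈ → <-irrefl refl (to (∈⟦⟧ (_<? y)) y∈)))

  μ-fuel-suc : ∀ k → x < y →
               μ-fuel (suc k) x y ≡ - ∑[ z < n ] (𝟙 ((x ≤? z) ×-dec (z <? y)) * μ-fuel k x z)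
  μ-fuel-suc {x} {y} k x<y with x ≟ y | x ≤? y
  ... | yes x≡y | _      = contradiction x≡y (proj₂ x<y)
  ... | no _    | no x≰y = contradiction (proj₁ x<y) x≰y
  ... | no _    | yes _  = cong -_ (foldr-filter-∑ (λ z → (x ≤? z) ×-dec (z <? y)) (μ-fuel k x) id)

  μ-fuel-suc-≮ : ∀ k l → ¬ x < y → μ-fuel (suc k) x y ≡ μ-fuel (suc l) x y
  μ-fuel-suc-≮ {x} {y} k l x≮y with x ≟ y | x ≤? y
  ... | yes _   | _      = refl
  ... | no _    | no _   = refl
  ... | no x≢y  | yes x≤y = contradiction (x≤y , x≢y) x≮y

  μ-fuel-stable : ∀ {k l} x y → height y ℕ.< k → height y ℕ.< l → μ-fuel k x y ≡ μ-fuel l x y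
  μ-fuel-stable {suc k} {suc l} x y (ℕ.s≤s hy≤k) (ℕ.s≤s hy≤l) with x <? y
  ... | no  x≮y = μ-fuel-suc-≮ k l x≮y
  ... | yes x<y = begin
    μ-fuel (suc k) x y
      ≡⟨ μ-fuel-suc k x<y ⟩
    - ∑[ z < n ] (𝟙 ((x ≤? z) ×-dec (z <? y)) * μ-fuel k x z)
      ≡⟨ cong -_ (sum-cong-≗ λ z → 𝟙-*-cong ((x ≤? z) ×-dec (z <? y)) λ (_ , z<y) →
           μ-fuel-stable x z (ℕ.<-≤-trans (height-mono z<y) hy≤k) (ℕ.<-≤-trans (height-mono z<y) hy≤l)) ⟩
    - ∑[ z < n ] (𝟙 ((x ≤? z) ×-dec (z <? y)) * μ-fuel l x z)
      ≡⟨ sym (μ-fuel-suc l x<y) ⟩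
    μ-fuel (suc l) x y ∎
    where open ≡-Reasoning

  μ-unfold : ∀ x y → μ x y ≡ μ-fuel (suc (height y)) x y
  μ-unfold x y = μ-fuel-stable x y height<n (ℕ.n<1+n (height y))

  μ-refl : ∀ x → μ x x ≡ 1ℤ
  μ-refl x = trans (μ-unfold x x) (unfold-diagonal (height x))
    where
    unfold-diagonal : ∀ k → μ-fuel (suc k) x x ≡ 1ℤ
    unfold-diagonal k with x ≟ x
    ... | yes _   = refl
    ... | no  x≢x = contradiction refl x≢x

  μ-rec : x < y → μ x y ≡ - ∑[ z < n ] (𝟙 ((x ≤? z) ×-dec (z <? y)) * μ x z)
  μ-rec {x} {y} x<y = begin
    μ x y
      ≡⟨ μ-unfold x y ⟩
    μ-fuel (suc (height y)) x y
      ≡⟨ μ-fuel-suc (height y) x<y ⟩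
    - ∑[ z < n ] (𝟙 ((x ≤? z) ×-dec (z <? y)) * μ-fuel (height y) x z)
      ≡⟨ cong -_ (sum-cong-≗ λ z → 𝟙-*-cong ((x ≤? z) ×-dec (z <? y)) λ (_ , z<y) →
           μ-fuel-stable x z (height-mono z<y) height<n) ⟩
    - ∑[ z < n ] (𝟙 ((x ≤? z) ×-dec (z <? y)) * μ x z) ∎
    where open ≡-Reasoning

  𝟙-≤≤-split : x ≤ w → ∀ z →
               𝟙 ((x ≤? z) ×-dec (z ≤? w)) ≡ 𝟙 (z ≟ w) + 𝟙 ((x ≤? z) ×-dec (z <? w))
  𝟙-≤≤-split {x} {w} x≤w z =
    trans (𝟙-cong (mk⇔ split unsplit)
                  ((x ≤? z) ×-dec (z ≤? w)) ((z ≟ w) ⊎-dec ((x ≤? z) ×-dec (z <? w))))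
          (𝟙-⊎ (λ (z≡w , _ , z<w) → proj₂ z<w z≡w) (z ≟ w) ((x ≤? z) ×-dec (z <? w)))
    where
    split : x ≤ z × z ≤ w → z ≡ w ⊎ (x ≤ z × z < w)
    split (x≤z , z≤w) with z ≟ w
    ... | yes z≡w = inj₁ z≡w
    ... | no  z≢w = inj₂ (x≤z , z≤w , z≢w)
    unsplit : z ≡ w ⊎ (x ≤ z × z < w) → x ≤ z × z ≤ w
    unsplit (inj₁ refl)         = x≤w , ≤-refl
    unsplit (inj₂ (x≤z , z<w)) = x≤z , proj₁ z<w

  ∑-μ : x ≤ w → ∑[ z < n ] (𝟙 ((x ≤? z) ×-dec (z ≤? w)) * μ x z) ≡ 𝟙 (x ≟ w)
  ∑-μ {x} {w} x≤w = begin
    ∑[ z < n ] (𝟙 ((x ≤? z) ×-dec (z ≤? w)) * μ x z)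
      ≡⟨ sum-cong-≗ (λ z → trans (cong (_* μ x z) (𝟙-≤≤-split x≤w z))
                                 (ℤ.*-distribʳ-+ (μ x z) (𝟙 (z ≟ w)) (𝟙 ((x ≤? z) ×-dec (z <? w))))) ⟩
    ∑[ z < n ] (𝟙 (z ≟ w) * μ x z + 𝟙 ((x ≤? z) ×-dec (z <? w)) * μ x z)
      ≡⟨ ∑-distrib-+ (λ z → 𝟙 (z ≟ w) * μ x z) (λ z → 𝟙 ((x ≤? z) ×-dec (z <? w)) * μ x z) ⟩
    ∑[ z < n ] (𝟙 (z ≟ w) * μ x z) + below-w
      ≡⟨ cong (_+ below-w) (∑-δ w (μ x)) ⟩
    μ x w + below-w
      ≡⟨ by-cases (x ≟ w) ⟩
    𝟙 (x ≟ w) ∎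
    where
    open ≡-Reasoning
    below-w = ∑[ z < n ] (𝟙 ((x ≤? z) ×-dec (z <? w)) * μ x z)
    by-cases : (x≟w : Dec (x ≡ w)) → μ x w + below-w ≡ 𝟙 x≟w
    by-cases (yes x≡w) = cong₂ _+_ (trans (cong (μ x) (sym x≡w)) (μ-refl x)) (∑-zero λ z →
      𝟙-*-zero ((x ≤? z) ×-dec (z <? w)) λ (x≤z , z<w) →
        <⇒≱ z<w (≤-trans (≤-reflexive (sym x≡w)) x≤z))
    by-cases (no x≢w)  = trans (cong (_+ below-w) (μ-rec (x≤w , x≢w))) (ℤ.+-inverseˡ below-w)

  crosscutTerm : Decidable P → Subset n → ℤ
  crosscutTerm C? S = -1ℤ ^ ∣ S ∣ * 𝟙 (Lift? C? S ×-dec ⊥ ≟ ⋀ (_∈? S))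

  crosscutTerm-zero : (C? : Decidable P) → ∀ S → ¬ (Lift P S × ⊥ ≡ ⋀ (_∈? S)) → crosscutTerm C? S ≡ 0ℤ
  crosscutTerm-zero C? S ¬contributes = trans
    (cong (-1ℤ ^ ∣ S ∣ *_) (𝟙-no (Lift? C? S ×-dec ⊥ ≟ ⋀ (_∈? S)) ¬contributes))
    (ℤ.*-zeroʳ (-1ℤ ^ ∣ S ∣))

  module _ {C : Pred (Fin n) p} (C? : Decidable C) (⊤∉C : ¬ C ⊤)
           (C-above : ∀ {x} → x ≢ ⊤ → ∃[ c ] C c × x ≤ c) where

    -- Inclusion–exclusion over the elements of C above x.
    crosscut-indicator : ∀ x →
                         ∑ˢ (λ S → -1ℤ ^ ∣ S ∣ * 𝟙 (Lift? C? S) * 𝟙 (x ≤? ⋀ (_∈? S))) ≡ 𝟙 (x ≟ ⊤)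
    crosscut-indicator x = begin
      ∑ˢ (λ S → -1ℤ ^ ∣ S ∣ * 𝟙 (Lift? C? S) * 𝟙 (x ≤? ⋀ (_∈? S)))
        ≡⟨ ∑ˢ-cong (λ S → trans (ℤ.*-assoc (-1ℤ ^ ∣ S ∣) (𝟙 (Lift? C? S)) (𝟙 (x ≤? ⋀ (_∈? S))))
                                (cong (-1ℤ ^ ∣ S ∣ *_) (merge S))) ⟩
      ∑ˢ (λ S → -1ℤ ^ ∣ S ∣ * 𝟙 (Lift? C↑x? S))
        ≡⟨ ∑ˢ-alternating C↑x? ⟩
      𝟙 (all? (¬? ∘ C↑x?))
        ≡⟨ 𝟙-cong none-above⇔≡⊤ (all? (¬? ∘ C↑x?)) (x ≟ ⊤) ⟩
      𝟙 (x ≟ ⊤) ∎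
      where
      open ≡-Reasoning
      C↑x? : Decidable (λ i → C i × x ≤ i)
      C↑x? i = C? i ×-dec x ≤? i
      lift-≤⋀ : ∀ {S} → (Lift C S × x ≤ ⋀ (_∈? S)) ⇔ Lift (λ i → C i × x ≤ i) S
      lift-≤⋀ {S} = mk⇔ to′ from′
        where
        to′ : Lift C S × x ≤ ⋀ (_∈? S) → Lift (λ i → C i × x ≤ i) S
        to′ (C[S] , x≤⋀S) i∈S = C[S] i∈S , ≤-trans x≤⋀S (⋀-lowerBound (_∈? S) i∈S)
        from′ : Lift (λ i → C i × x ≤ i) S → Lift C S × x ≤ ⋀ (_∈? S)
        from′ C↑x[S] = proj₁ ∘ C↑x[S] , ⋀-greatest (_∈? S) (proj₂ ∘ C↑x[S])
      merge : ∀ S → 𝟙 (Lift? C? S) * 𝟙 (x ≤? ⋀ (_∈? S)) ≡ 𝟙 (Lift? C↑x? S)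
      merge S = trans (sym (𝟙-× (Lift? C? S) (x ≤? ⋀ (_∈? S))))
                      (𝟙-cong lift-≤⋀ (Lift? C? S ×-dec x ≤? ⋀ (_∈? S)) (Lift? C↑x? S))
      none-above⇔≡⊤ : (∀ i → ¬ (C i × x ≤ i)) ⇔ x ≡ ⊤
      none-above⇔≡⊤ = mk⇔ to′ λ x≡⊤ i (Ci , x≤i) →
        ⊤∉C (subst C (≤-antisym (⊤-max i) (≤-trans (≤-reflexive (sym x≡⊤)) x≤i)) Ci)
        where
        to′ : (∀ i → ¬ (C i × x ≤ i)) → x ≡ ⊤
        to′ none-above with x ≟ ⊤
        ... | yes x≡⊤ = x≡⊤
        ... | no  x≢⊤ = let c , Cc , x≤c = C-above x≢⊤ in contradiction (Cc , x≤c) (none-above c)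

    crosscut : μ ⊥ ⊤ ≡ ∑ˢ (crosscutTerm C?)
    crosscut = begin
      μ ⊥ ⊤
        ≡⟨ sym (∑-δ ⊤ (μ ⊥)) ⟩
      ∑[ x < n ] (𝟙 (x ≟ ⊤) * μ ⊥ x)
        ≡⟨ sum-cong-≗ (λ x → trans (ℤ.*-comm (𝟙 (x ≟ ⊤)) (μ ⊥ x))
                                   (cong (μ ⊥ x *_) (sym (crosscut-indicator x)))) ⟩
      ∑[ x < n ] (μ ⊥ x * ∑ˢ (λ S → σ S * 𝟙 (x ≤? ⋀ (_∈? S))))
        ≡⟨ sum-cong-≗ (λ x → *-distribˡ-∑ˢ (μ ⊥ x) (λ S → σ S * 𝟙 (x ≤? ⋀ (_∈? S)))) ⟩
      ∑[ x < n ] ∑ˢ (λ S → μ ⊥ x * (σ S * 𝟙 (x ≤? ⋀ (_∈? S))))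
        ≡⟨ ∑-∑ˢ-comm (λ x S → μ ⊥ x * (σ S * 𝟙 (x ≤? ⋀ (_∈? S)))) ⟩
      ∑ˢ (λ S → ∑[ x < n ] (μ ⊥ x * (σ S * 𝟙 (x ≤? ⋀ (_∈? S)))))
        ≡⟨ ∑ˢ-cong (λ S → trans (sum-cong-≗ λ x → reassociate (μ ⊥ x) (σ S) (𝟙 (x ≤? ⋀ (_∈? S))))
                                (sym (*-distribˡ-sum (σ S) λ x → 𝟙 (x ≤? ⋀ (_∈? S)) * μ ⊥ x))) ⟩
      ∑ˢ (λ S → σ S * ∑[ x < n ] (𝟙 (x ≤? ⋀ (_∈? S)) * μ ⊥ x))
        ≡⟨ ∑ˢ-cong (λ S → cong (σ S *_) (∑-μ-⊥ (⋀ (_∈? S)))) ⟩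
      ∑ˢ (λ S → σ S * 𝟙 (⊥ ≟ ⋀ (_∈? S)))
        ≡⟨ ∑ˢ-cong (λ S → trans (ℤ.*-assoc (-1ℤ ^ ∣ S ∣) (𝟙 (Lift? C? S)) (𝟙 (⊥ ≟ ⋀ (_∈? S))))
                                (cong (-1ℤ ^ ∣ S ∣ *_) (sym (𝟙-× (Lift? C? S) (⊥ ≟ ⋀ (_∈? S)))))) ⟩
      ∑ˢ (crosscutTerm C?) ∎
      where
      open ≡-Reasoning
      σ : Subset n → ℤ
      σ S = -1ℤ ^ ∣ S ∣ * 𝟙 (Lift? C? S)
      reassociate : ∀ a b c → a * (b * c) ≡ b * (c * a)
      reassociate a b c = trans (ℤ.*-comm a (b * c)) (ℤ.*-assoc b c a)
      ∑-μ-⊥ : ∀ w → ∑[ x < n ] (𝟙 (x ≤? w) * μ ⊥ x) ≡ 𝟙 (⊥ ≟ w)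
      ∑-μ-⊥ w = trans (sum-cong-≗ λ x → cong (_* μ ⊥ x)
                         (𝟙-cong (mk⇔ (⊥-min x ,_) proj₂) (x ≤? w) ((⊥ ≤? x) ×-dec (x ≤? w))))
                      (∑-μ (⊥-min w))

  coatom-above : x ≢ ⊤ → ∃[ c ] c ⋖ ⊤ × x ≤ c
  coatom-above x≢⊤ with ∃-⋖-below (⊤-max _ , x≢⊤)
  ... | c , x≤c , c⋖⊤ = c , c⋖⊤ , x≤c

  crosscut-coatoms : μ ⊥ ⊤ ≡ ∑ˢ (crosscutTerm (_⋖? ⊤))
  crosscut-coatoms = crosscut (_⋖? ⊤) (λ ⊤⋖⊤ → <-irrefl refl (proj₁ ⊤⋖⊤)) coatom-above

  nucleus≤⋀ : ∀ {S} → Lift (_⋖ ⊤) S → nucleus ⊤ ≤ ⋀ (_∈? S)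
  nucleus≤⋀ {S} coatoms = ⋀-greatest (_∈? S) (⋀-lowerBound (_⋖? ⊤) ∘ coatoms)

  nucleus≢⊥⇒μ≡0 : nucleus ⊤ ≢ ⊥ → μ ⊥ ⊤ ≡ 0ℤ
  nucleus≢⊥⇒μ≡0 ⊤↓≢⊥ = trans crosscut-coatoms (∑ˢ-zero λ S →
    crosscutTerm-zero (_⋖? ⊤) S λ (coatoms , ⊥≡⋀S) →
      ⊤↓≢⊥ (≤-antisym (≤-trans (nucleus≤⋀ coatoms) (≤-reflexive (sym ⊥≡⋀S))) (⊥-min _)))

  ⋖-∨ : c ⋖ v → d ⋖ v → c ≢ d → c ∨ d ≡ v
  ⋖-∨ {c} {v} {d} c⋖v d⋖v c≢d =
    ⋖-between c⋖v (x≤x∨y c d , c≢c∨d) (∨-least (proj₁ (proj₁ c⋖v)) (proj₁ (proj₁ d⋖v)))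
    where
    c≢c∨d : c ≢ c ∨ d
    c≢c∨d c≡c∨d =
      proj₂ d⋖v c (≤-trans (y≤x∨y c d) (≤-reflexive (sym c≡c∨d)) , c≢d ∘ sym) (proj₁ c⋖v)

  ∨-⋀≡⊤ : JoinSemidistributive → (P? : Decidable P) →
          (∀ {i} → P i → c ∨ i ≡ ⊤) → c ∨ ⋀ P? ≡ ⊤
  ∨-⋀≡⊤ {c = c} jsd P? = ⋀-closed P? (≤-antisym (⊤-max _) (y≤x∨y c ⊤))
    (λ c∨x≡⊤ c∨y≡⊤ → trans (jsd (trans c∨x≡⊤ (sym c∨y≡⊤))) c∨x≡⊤)

  ⋀≡⊥⇒all-coatoms : JoinSemidistributive → ∀ {S} → Lift (_⋖ ⊤) S → ⊥ ≡ ⋀ (_∈? S) →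
                    S ≡ ⟦ _⋖? ⊤ ⟧
  ⋀≡⊥⇒all-coatoms jsd {S} coatoms ⊥≡⋀S =
    ⊆-antisym (from (∈⟦⟧ (_⋖? ⊤)) ∘ coatoms) every-coatom-in-S
    where
    every-coatom-in-S : ⟦ _⋖? ⊤ ⟧ ⊆ S
    every-coatom-in-S {c} c∈ with c ∈? S
    ... | yes c∈S = c∈S
    ... | no  c∉S = contradiction c≡⊤ (proj₂ (proj₁ c⋖⊤))
      where
      c⋖⊤ = to (∈⟦⟧ (_⋖? ⊤)) c∈
      c∨i≡⊤ : ∀ {i} → i ∈ S → c ∨ i ≡ ⊤
      c∨i≡⊤ i∈S = ⋖-∨ c⋖⊤ (coatoms i∈S) λ { refl → c∉S i∈S }
      c≡⊤ : c ≡ ⊤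
      c≡⊤ = begin
        c             ≡⟨ sym (trans (∨-comm c ⊥) (x≤y⇒x∨y≈y (⊥-min c))) ⟩
        c ∨ ⊥         ≡⟨ cong (c ∨_) ⊥≡⋀S ⟩
        c ∨ ⋀ (_∈? S) ≡⟨ ∨-⋀≡⊤ jsd (_∈? S) c∨i≡⊤ ⟩
        ⊤             ∎
        where open ≡-Reasoning

  nucleus≡⊥⇒μ≡±1 : JoinSemidistributive → nucleus ⊤ ≡ ⊥ → μ ⊥ ⊤ ≡ -1ℤ ^ ∣ ⟦ _⋖? ⊤ ⟧ ∣
  nucleus≡⊥⇒μ≡±1 jsd ⊤↓≡⊥ = begin
    μ ⊥ ⊤                        ≡⟨ crosscut-coatoms ⟩
    ∑ˢ (crosscutTerm (_⋖? ⊤))    ≡⟨ ∑ˢ-single (crosscutTerm (_⋖? ⊤)) coatoms only-coatoms-contribute ⟩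
    crosscutTerm (_⋖? ⊤) coatoms ≡⟨ cong (-1ℤ ^ ∣ coatoms ∣ *_) coatoms-contribute ⟩
    -1ℤ ^ ∣ coatoms ∣ * 1ℤ       ≡⟨ ℤ.*-identityʳ _ ⟩
    -1ℤ ^ ∣ coatoms ∣            ∎
    where
    open ≡-Reasoning
    coatoms = ⟦ _⋖? ⊤ ⟧
    only-coatoms-contribute : ∀ S → S ≢ coatoms → crosscutTerm (_⋖? ⊤) S ≡ 0ℤ
    only-coatoms-contribute S S≢coatoms = crosscutTerm-zero (_⋖? ⊤) S λ (S-coatoms , ⊥≡⋀S) →
      S≢coatoms (⋀≡⊥⇒all-coatoms jsd S-coatoms ⊥≡⋀S)
    ⋖⊤[coatoms] : Lift (_⋖ ⊤) coatoms
    ⋖⊤[coatoms] = to (∈⟦⟧ (_⋖? ⊤))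
    ⊥≡⋀coatoms : ⊥ ≡ ⋀ (_∈? coatoms)
    ⊥≡⋀coatoms = ≤-antisym (⊥-min _) (≤-trans
      (⋀-greatest (_⋖? ⊤) (⋀-lowerBound (_∈? coatoms) ∘ from (∈⟦⟧ (_⋖? ⊤)))) (≤-reflexive ⊤↓≡⊥))
    coatoms-contribute : 𝟙 (Lift? (_⋖? ⊤) coatoms ×-dec ⊥ ≟ ⋀ (_∈? coatoms)) ≡ 1ℤ
    coatoms-contribute = 𝟙-yes (Lift? (_⋖? ⊤) coatoms ×-dec ⊥ ≟ ⋀ (_∈? coatoms)) (⋖⊤[coatoms] , ⊥≡⋀coatoms)

  nucleus≡⊥⇒μ≢0 : JoinSemidistributive → nucleus ⊤ ≡ ⊥ → μ ⊥ ⊤ ≢ 0ℤ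
  nucleus≡⊥⇒μ≢0 jsd ⊤↓≡⊥ μ≡0 =
    contradiction (ℤ.i^n≡0⇒i≡0 -1ℤ ∣ ⟦ _⋖? ⊤ ⟧ ∣ (trans (sym (nucleus≡⊥⇒μ≡±1 jsd ⊤↓≡⊥)) μ≡0))
                  λ ()

open Defs using (IsCongruenceUniform; IsJoinIrreducible; _∈Ψ_; μ)

lemma4p5 : (L : FiniteLattice) → IsCongruenceUniform L
         → ((∀ j → _∈Ψ_ L j (FiniteLattice.⊤ L) → IsJoinIrreducible L j)
            × (∀ j → IsJoinIrreducible L j → _∈Ψ_ L j (FiniteLattice.⊤ L)))
           ⇔ (¬ (μ L (FiniteLattice.⊥ L) (FiniteLattice.⊤ L) ≡ 0ℤ))
lemma4p5 L congruenceUniform = mk⇔ (μ≢0 ∘ proj₂) λ μ≢0 → (λ _ → proj₁) , J⊆Ψ μ≢0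
  where
  open FiniteLattice L using (⊤; ⊥; ⊤-max)
  open Properties L using (JoinCgInjective; cgInjective⇒joinSemidistributive; nucleus; nucleus≡⊥⇒∈Ψ;
    nucleus≢⊥⇒∃joinIrreducible∉Ψ; nucleus≢⊥⇒μ≡0; nucleus≡⊥⇒μ≢0)

  injective : JoinCgInjective
  injective = proj₁ (proj₂ (proj₁ congruenceUniform))

  μ≢0 : (∀ j → IsJoinIrreducible L j → _∈Ψ_ L j ⊤) → μ L ⊥ ⊤ ≢ 0ℤ
  μ≢0 J⊆Ψ with nucleus ⊤ ≟ ⊥
  ... | yes ⊤↓≡⊥ = nucleus≡⊥⇒μ≢0 (cgInjective⇒joinSemidistributive injective) ⊤↓≡⊥
  ... | no  ⊤↓≢⊥ =
    let a , aJI , a∉Ψ = nucleus≢⊥⇒∃joinIrreducible∉Ψ injective ⊤↓≢⊥ in contradiction (J⊆Ψ a aJI) a∉Ψ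

  J⊆Ψ : μ L ⊥ ⊤ ≢ 0ℤ → ∀ j → IsJoinIrreducible L j → _∈Ψ_ L j ⊤
  J⊆Ψ μ≢0 j jJI =
    nucleus≡⊥⇒∈Ψ (decidable-stable (nucleus ⊤ ≟ ⊥) (μ≢0 ∘ nucleus≢⊥⇒μ≡0)) (⊤-max j) jJI
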